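{- Let $p,q\ge2$ be integers, let $F$ be a spanning subgraph of $K_{p,q}$, let $G$ be a finite simple bipartite graph, and let $\ell=pq-|E(F)|$. Let $F_0,F_1,\dots,F_\ell$ be any sequence of spanning subgraphs of $K_{p,q}$ with $F_0=K_{p,q}$, $F_\ell=F$, and $F_k$ obtained from $F_{k-1}$ by removing a single edge for each $k\in\{1,\dots,\ell\}$. Define $\Delta_k=\hom(F_k,G)-\hom(F_{k-1},G)$. Then $\Delta_k\ge\eta_{p,q}(G)$ for every $k\in\{1,\dots,\ell\}$.
   Context: $\hom(F,G)$ is the number of maps $\phi:V(F)\to V(G)$ sending every edge of $F$ to an edge of $G$. $K_{p,q}$ is the complete bipartite graph with partite sets of sizes $p$ and $q$. $\mathcal{N}_G(x)$ is the neighbourhood of $x$ in $G$. Let $\mathcal{D}=\{(u,v)\in V(G)\times V(G):\ \{u,v\}\notin E(G),\ \exists\, w\in\mathcal{N}_G(u)\text{ with }\mathcal{N}_G(v)\cap\mathcal{N}_G(w)\ne\emptyset\}$ and $\eta_{p,q}(G)=\sum_{(u,v)\in\mathcal{D}}\sum_{w\in\mathcal{N}_G(u):\ \mathcal{N}_G(v)\cap\mathcal{N}_G(w)\neq\emptyset}|\mathcal{N}_G(v)\cap\mathcal{N}_G(w)|^{\max\{p,q\}-1}$. -}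

module Defs where

open import Data.Nat using (ℕ; zero; suc; _+_; _*_; _∸_; _^_; _⊔_; _≤_; _<_)
open import Data.Bool using (Bool; true; false; if_then_else_; _∧_; _∨_; not)
open import Data.Fin using (Fin; zero; suc)
open import Data.List using (List; []; _∷_; map; concatMap; allFin)
open import Data.Nat.ListAction using (sum)
open import Data.Bool.ListAction using (and; or)
open import Data.Product using (Σ; _×_; _,_)
open import Relation.Binary.PropositionalEquality using (_≡_; _≢_)
open import Data.Integer using (ℤ; +_; _-_)

record SimpleGraph : Set where
  field
    n      : ℕ
    adj    : Fin n → Fin n → Bool
    sym    : ∀ u v → adj u v ≡ adj v u
    irrefl : ∀ u → adj u u ≡ false

open SimpleGraph public

IsBipartite : SimpleGraph → Set
IsBipartite G = Σ (Fin (n G) → Bool) λ c → ∀ u v → adj G u v ≡ true → c u ≢ c v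

-- Spanning subgraphs of K_{p,q}: vertex set Fin p ⊎ Fin q (the two
-- partite sets), edge set a subset of Fin p × Fin q.

BipEdgeSet : ℕ → ℕ → Set
BipEdgeSet p q = Fin p → Fin q → Bool

complete : ∀ {p q} → BipEdgeSet p q
complete _ _ = true

bit : Bool → ℕ
bit true  = 1
bit false = 0

edgeCount : ∀ {p q} → BipEdgeSet p q → ℕ
edgeCount {p} {q} F = sum (map (λ i → sum (map (λ j → bit (F i j)) (allFin q))) (allFin p))

RemoveOneEdge : ∀ {p q} → BipEdgeSet p q → BipEdgeSet p q → Set
RemoveOneEdge {p} {q} F F' =
  Σ (Fin p) λ i → Σ (Fin q) λ j →
    (F i j ≡ true) × (F' i j ≡ false) ×
    (∀ i' j' → (i' ≡ i → j' ≢ j) → F' i' j' ≡ F i' j')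

cons : ∀ {m k} → Fin k → (Fin m → Fin k) → Fin (suc m) → Fin k
cons x f zero    = x
cons x f (suc i) = f i

allFuns : (m k : ℕ) → List (Fin m → Fin k)
allFuns zero    k = (λ ()) ∷ []
allFuns (suc m) k = concatMap (λ f → map (λ x → cons x f) (allFin k)) (allFuns m k)

count : ∀ {A : Set} → (A → Bool) → List A → ℕ
count P xs = sum (map (λ x → bit (P x)) xs)

isHom : ∀ {p q} (F : BipEdgeSet p q) (G : SimpleGraph) →
        (Fin p → Fin (n G)) → (Fin q → Fin (n G)) → Bool
isHom {p} {q} F G α β =
  and (map (λ i → and (map (λ j → not (F i j) ∨ adj G (α i) (β j)) (allFin q))) (allFin p))

hom : ∀ {p q} → BipEdgeSet p q → SimpleGraph → ℕ
hom {p} {q} F G =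
  sum (map (λ α → count (λ β → isHom F G α β) (allFuns q (n G))) (allFuns p (n G)))

module _ (G : SimpleGraph) where
  private
    V = allFin (n G)

  commonNbrs : Fin (n G) → Fin (n G) → ℕ
  commonNbrs v w = count (λ x → adj G v x ∧ adj G w x) V

  nonzero : ℕ → Bool
  nonzero zero    = false
  nonzero (suc _) = true

  goodW : Fin (n G) → Fin (n G) → Fin (n G) → Bool
  goodW u v w = adj G u w ∧ nonzero (commonNbrs v w)

  inD : Fin (n G) → Fin (n G) → Bool
  inD u v = not (adj G u v) ∧ or (map (goodW u v) V)

  eta : ℕ → ℕ → ℕ
  eta p q =
    sum (map (λ u → sum (map (λ v →
      if inD u v
      then sum (map (λ w → if goodW u v w then commonNbrs v w ^ ((p ⊔ q) ∸ 1) else 0) V)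
      else 0) V)) V)

{-# OPTIONS --safe #-}
-- Deleting an edge from F can only create homomorphisms, so hom(F_k, G) − hom(F_{k−1}, G)
-- is the number of maps (α, β) : [p] ⊎ [q] → V(G) that are homomorphisms of F_k but not of
-- F_{k−1}. Let {i, j} be the deleted edge and, transposing if necessary, p = max{p, q}; fix
-- j₀ ≠ j on the q-side. For each triple (u, v, w) with u ≁ v, u ∼ w and N(v) ∩ N(w) ≠ ∅,
-- the maps with α i = u, α t ∈ N(v) ∩ N(w) for t ≠ i, β j = v and β t = w for t ≠ j are such
-- new homomorphisms. They form a box of maps, so there are |N(v) ∩ N(w)|^(p−1) of them, and
-- each determines its triple as (α i, β j, β j₀); summing over the triples gives η_{p,q}(G).
module Submission where

open import Defs renaming (sym to adj-sym)
open import Data.Nat using (ℕ; suc; _*_; _∸_; _≤_)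
open import Data.Integer using (+_; _-_) renaming (_≤_ to _≤ℤ_)
open import Data.Fin using (Fin)
open import Relation.Binary.PropositionalEquality using (_≡_)

open import Data.Bool using (Bool; true; false; _∧_; _∨_; not; if_then_else_)
open import Data.Bool.ListAction using (all)
open import Data.Bool.Properties using (¬-not; not-injective; ⇔→≡)
open import Data.Fin using (zero; suc; punchIn)
open import Data.Fin.Properties using (_≟_; suc-injective; punchInᵢ≢i)
open import Data.Integer using (+≤+)
open import Data.Integer.Properties using ([+m]-[+n]≡m⊖n; ⊖-≥)
open import Data.List using (List; []; _∷_; _++_; map; concatMap; allFin)
open import Data.List.Properties using (map-++; map-tabulate)
open import Data.Nat using (zero; _+_; _^_; _⊔_; z≤n; s≤s)
open import Data.Nat.ListAction using (sum)
open import Data.Nat.ListAction.Properties using (sum-++)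
open import Data.Nat.Properties
  using ( +-identityʳ; *-identityˡ; *-identityʳ; *-zeroʳ; *-distribˡ-+; *-distribʳ-+; ^-zeroˡ
        ; +-commutativeSemigroup; ≤-refl; ≤-reflexive; ≤-trans; ≤-total; +-mono-≤
        ; m≤m+n; m+n∸m≡n; m≥n⇒m⊔n≡m; m≤n⇒m⊔n≡n; module ≤-Reasoning )
open import Algebra.Properties.CommutativeSemigroup +-commutativeSemigroup using (interchange)
open import Data.Product using (Σ; _×_; _,_; proj₁; proj₂)
open import Data.Sum using (inj₁; inj₂)
open import Function using (id; _∘_; mk⇔)
open import Relation.Nullary using (Dec; yes; no; does; ¬_; contradiction)
open import Relation.Nullary.Decidable using (dec-true; dec-false)
open import Relation.Binary.PropositionalEquality
  using (refl; sym; trans; cong; cong₂; subst; _≢_; module ≡-Reasoning)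

private
  variable
    A B : Set
    k m p q : ℕ

bit-∧ : ∀ x y → bit (x ∧ y) ≡ bit x * bit y
bit-∧ true  y = sym (+-identityʳ (bit y))
bit-∧ false y = refl

bit-mono : ∀ {x y} → (x ≡ true → y ≡ true) → bit x ≤ bit y
bit-mono {false} _   = z≤n
bit-mono {true}  x⇒y rewrite x⇒y refl = ≤-refl

bit-split : ∀ {x y} → (x ≡ true → y ≡ true) → bit y ≡ bit x + bit (y ∧ not x)
bit-split {true}  x⇒y rewrite x⇒y refl = refl
bit-split {false} {false} _ = refl
bit-split {false} {true}  _ = refl

∧-true⁻ : ∀ {x y} → x ∧ y ≡ true → x ≡ true × y ≡ true
∧-true⁻ {true} y≡true = refl , y≡true

not-∨-intro : ∀ {x y} → (x ≡ true → y ≡ true) → not x ∨ y ≡ true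
not-∨-intro {true}  x⇒y = x⇒y refl
not-∨-intro {false} _   = refl

does-true⇒ : ∀ {P : Set} (P? : Dec P) → does P? ≡ true → P
does-true⇒ (yes p) _ = p
does-true⇒ (no _) ()

if-yes : ∀ {P : Set} (P? : Dec P) {x y : A} → P → (if does P? then x else y) ≡ x
if-yes P? p = cong (if_then _ else _) (dec-true P? p)

if-no : ∀ {P : Set} (P? : Dec P) {x y : A} → ¬ P → (if does P? then x else y) ≡ y
if-no P? ¬p = cong (if_then _ else _) (dec-false P? ¬p)

∑ : List A → (A → ℕ) → ℕ
∑ xs f = sum (map f xs)

infixr 10 ∑
syntax ∑ xs (λ x → e) = ∑[ x ∈ xs ] e

∑-cong : (xs : List A) {f g : A → ℕ} → (∀ x → f x ≡ g x) → ∑ xs f ≡ ∑ xs g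
∑-cong []       _   = refl
∑-cong (x ∷ xs) f≗g = cong₂ _+_ (f≗g x) (∑-cong xs f≗g)

∑-zero : (xs : List A) {f : A → ℕ} → (∀ x → f x ≡ 0) → ∑ xs f ≡ 0
∑-zero []       _   = refl
∑-zero (x ∷ xs) f≗0 = cong₂ _+_ (f≗0 x) (∑-zero xs f≗0)

∑-mono-≤ : (xs : List A) {f g : A → ℕ} → (∀ x → f x ≤ g x) → ∑ xs f ≤ ∑ xs g
∑-mono-≤ []       _   = z≤n
∑-mono-≤ (x ∷ xs) f≤g = +-mono-≤ (f≤g x) (∑-mono-≤ xs f≤g)

∑-+ : (xs : List A) (f g : A → ℕ) → ∑[ x ∈ xs ] (f x + g x) ≡ ∑ xs f + ∑ xs g
∑-+ []       f g = refl
∑-+ (x ∷ xs) f g =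
  trans (cong (_+_ (f x + g x)) (∑-+ xs f g)) (interchange (f x) (g x) (∑ xs f) (∑ xs g))

∑-*ˡ : (xs : List A) (c : ℕ) (f : A → ℕ) → ∑[ x ∈ xs ] (c * f x) ≡ c * ∑ xs f
∑-*ˡ []       c f = sym (*-zeroʳ c)
∑-*ˡ (x ∷ xs) c f =
  trans (cong (_+_ (c * f x)) (∑-*ˡ xs c f)) (sym (*-distribˡ-+ c (f x) (∑ xs f)))

∑-*ʳ : (xs : List A) (f : A → ℕ) (c : ℕ) → ∑[ x ∈ xs ] (f x * c) ≡ ∑ xs f * c
∑-*ʳ []       f c = refl
∑-*ʳ (x ∷ xs) f c =
  trans (cong (_+_ (f x * c)) (∑-*ʳ xs f c)) (sym (*-distribʳ-+ c (f x) (∑ xs f)))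

∑-comm : (xs : List A) (ys : List B) (f : A → B → ℕ) →
         ∑[ x ∈ xs ] ∑[ y ∈ ys ] f x y ≡ ∑[ y ∈ ys ] ∑[ x ∈ xs ] f x y
∑-comm []       ys f = sym (∑-zero ys (λ _ → refl))
∑-comm (x ∷ xs) ys f =
  trans (cong (_+_ (∑ ys (f x))) (∑-comm xs ys f)) (sym (∑-+ ys (f x) (λ y → ∑[ x ∈ xs ] f x y)))

∑-comm² : ∀ {C : Set} (xs : List A) (ys : List B) (zs : List C) (f : A → B → C → ℕ) →
          ∑[ x ∈ xs ] ∑[ y ∈ ys ] ∑[ z ∈ zs ] f x y z
          ≡ ∑[ y ∈ ys ] ∑[ z ∈ zs ] ∑[ x ∈ xs ] f x y z
∑-comm² xs ys zs f =
  trans (∑-comm xs ys (λ x y → ∑[ z ∈ zs ] f x y z)) (∑-cong ys (λ y → ∑-comm xs zs (λ x → f x y)))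

∑-++ : (xs ys : List A) (f : A → ℕ) → ∑ (xs ++ ys) f ≡ ∑ xs f + ∑ ys f
∑-++ xs ys f = trans (cong sum (map-++ f xs ys)) (sum-++ (map f xs) (map f ys))

∑-concatMap : (h : A → List B) (xs : List A) (f : B → ℕ) →
              ∑ (concatMap h xs) f ≡ ∑[ x ∈ xs ] ∑ (h x) f
∑-concatMap h []       f = refl
∑-concatMap h (x ∷ xs) f =
  trans (∑-++ (h x) (concatMap h xs) f) (cong (_+_ (∑ (h x) f)) (∑-concatMap h xs f))

∑-map : (h : A → B) (xs : List A) (f : B → ℕ) → ∑ (map h xs) f ≡ ∑[ x ∈ xs ] f (h x)
∑-map h []       f = refl
∑-map h (x ∷ xs) f = cong (_+_ (f (h x))) (∑-map h xs f)

map-allFin-suc : (f : Fin (suc k) → A) → map f (allFin (suc k)) ≡ f zero ∷ map (f ∘ suc) (allFin k)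
map-allFin-suc f = cong (f zero ∷_) (trans (map-tabulate suc f) (sym (map-tabulate id (f ∘ suc))))

∑-allFin-suc : (f : Fin (suc k) → ℕ) → ∑ (allFin (suc k)) f ≡ f zero + ∑ (allFin k) (f ∘ suc)
∑-allFin-suc f = cong sum (map-allFin-suc f)

∑-allFin-single : (f : Fin k → ℕ) (a : Fin k) → (∀ t → t ≢ a → f t ≡ 0) → ∑ (allFin k) f ≡ f a
∑-allFin-single {suc k} f zero f≡0 = begin
  ∑ (allFin (suc k)) f            ≡⟨ ∑-allFin-suc f ⟩
  f zero + ∑ (allFin k) (f ∘ suc) ≡⟨ cong (_+_ (f zero)) (∑-zero (allFin k) (λ t → f≡0 (suc t) λ ())) ⟩
  f zero + 0                      ≡⟨ +-identityʳ (f zero) ⟩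
  f zero                          ∎
  where open ≡-Reasoning
∑-allFin-single {suc k} f (suc a) f≡0 =
  trans (∑-allFin-suc f)
        (cong₂ _+_ (f≡0 zero λ ())
                   (∑-allFin-single (f ∘ suc) a (λ t t≢a → f≡0 (suc t) (t≢a ∘ suc-injective))))

count-≟ : (a : Fin k) → count (λ x → does (x ≟ a)) (allFin k) ≡ 1
count-≟ a =
  trans (∑-allFin-single _ a (λ x x≢a → cong bit (dec-false (x ≟ a) x≢a)))
        (cong bit (dec-true (a ≟ a) refl))

all-allFin-suc : (P : Fin (suc k) → Bool) → all P (allFin (suc k)) ≡ P zero ∧ all (P ∘ suc) (allFin k)
all-allFin-suc P = cong Data.Bool.ListAction.and (map-allFin-suc P)

all-allFin⁻ : (P : Fin k → Bool) → all P (allFin k) ≡ true → ∀ t → P t ≡ true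
all-allFin⁻ {suc k} P all≡true zero    = proj₁ (∧-true⁻ (trans (sym (all-allFin-suc P)) all≡true))
all-allFin⁻ {suc k} P all≡true (suc t) =
  all-allFin⁻ (P ∘ suc) (proj₂ (∧-true⁻ (trans (sym (all-allFin-suc P)) all≡true))) t

all-allFin⁺ : (P : Fin k → Bool) → (∀ t → P t ≡ true) → all P (allFin k) ≡ true
all-allFin⁺ {zero}  P _      = refl
all-allFin⁺ {suc k} P P≡true =
  trans (all-allFin-suc P) (cong₂ _∧_ (P≡true zero) (all-allFin⁺ (P ∘ suc) (P≡true ∘ suc)))

∑-allFuns-suc : (g : (Fin (suc m) → Fin k) → ℕ) →
                ∑ (allFuns (suc m) k) g ≡ ∑[ f ∈ allFuns m k ] ∑[ x ∈ allFin k ] g (cons x f)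
∑-allFuns-suc {m} {k} g =
  trans (∑-concatMap _ (allFuns m k) g) (∑-cong (allFuns m k) (λ f → ∑-map (λ x → cons x f) (allFin k) g))

∏ : (m : ℕ) → (Fin m → ℕ) → ℕ
∏ zero    f = 1
∏ (suc m) f = f zero * ∏ m (f ∘ suc)

∏-const : (f : Fin m → ℕ) {c : ℕ} → (∀ t → f t ≡ c) → ∏ m f ≡ c ^ m
∏-const {zero}  f _    = refl
∏-const {suc m} f f≡c = cong₂ _*_ (f≡c zero) (∏-const (f ∘ suc) (f≡c ∘ suc))

∏-const-except : (f : Fin m → ℕ) (i : Fin m) {c : ℕ} →
                 f i ≡ 1 → (∀ t → t ≢ i → f t ≡ c) → ∏ m f ≡ c ^ (m ∸ 1)
∏-const-except {suc m} f zero f0≡1 f≡c =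
  trans (cong₂ _*_ f0≡1 (∏-const (f ∘ suc) (λ t → f≡c (suc t) λ ()))) (*-identityˡ _)
∏-const-except {suc (suc m)} f (suc i) fi≡1 f≡c =
  cong₂ _*_ (f≡c zero λ ())
            (∏-const-except (f ∘ suc) i fi≡1 (λ t t≢i → f≡c (suc t) (t≢i ∘ suc-injective)))

inBox : (Fin m → Fin k → Bool) → (Fin m → Fin k) → Bool
inBox {m} S f = all (λ t → S t (f t)) (allFin m)

inBox-at : (S : Fin m → Fin k → Bool) (f : Fin m → Fin k) → inBox S f ≡ true → ∀ t → S t (f t) ≡ true
inBox-at S f = all-allFin⁻ (λ t → S t (f t))

count-inBox : (S : Fin m → Fin k → Bool) →
              count (inBox S) (allFuns m k) ≡ ∏ m (λ t → count (S t) (allFin k))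
count-inBox {zero}      S = refl
count-inBox {suc m} {k} S = begin
  count (inBox S) (allFuns (suc m) k)
    ≡⟨ ∑-allFuns-suc (bit ∘ inBox S) ⟩
  ∑[ f ∈ allFuns m k ] ∑[ x ∈ allFin k ] bit (inBox S (cons x f))
    ≡⟨ ∑-cong (allFuns m k) (λ f → ∑-cong (allFin k) (λ x →
         trans (cong bit (all-allFin-suc (λ t → S t (cons x f t)))) (bit-∧ (S zero x) _))) ⟩
  ∑[ f ∈ allFuns m k ] ∑[ x ∈ allFin k ] (bit (S zero x) * bit (inBox (S ∘ suc) f))
    ≡⟨ ∑-cong (allFuns m k) (λ f → ∑-*ʳ (allFin k) (bit ∘ S zero) _) ⟩
  ∑[ f ∈ allFuns m k ] (count (S zero) (allFin k) * bit (inBox (S ∘ suc) f))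
    ≡⟨ ∑-*ˡ (allFuns m k) (count (S zero) (allFin k)) (bit ∘ inBox (S ∘ suc)) ⟩
  count (S zero) (allFin k) * count (inBox (S ∘ suc)) (allFuns m k)
    ≡⟨ cong (count (S zero) (allFin k) *_) (count-inBox (S ∘ suc)) ⟩
  ∏ (suc m) (λ t → count (S t) (allFin k)) ∎
  where open ≡-Reasoning

_⊆ₑ_ : BipEdgeSet p q → BipEdgeSet p q → Set
F' ⊆ₑ F = ∀ i j → F' i j ≡ true → F i j ≡ true

RemoveOneEdge⇒⊆ₑ : (F F' : BipEdgeSet p q) → RemoveOneEdge F F' → F' ⊆ₑ F
RemoveOneEdge⇒⊆ₑ F F' (i , j , _ , F'ij , unchanged) i' j' F'i'j'
  with j' ≟ j | i' ≟ i
... | no j'≢j | _        = trans (sym (unchanged i' j' λ _ → j'≢j)) F'i'j'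
... | yes _   | no i'≢i  = trans (sym (unchanged i' j' λ i'≡i → contradiction i'≡i i'≢i)) F'i'j'
... | yes refl | yes refl = contradiction (trans (sym F'i'j') F'ij) λ ()

other-index : 2 ≤ q → (j : Fin q) → Σ (Fin q) (_≢ j)
other-index (s≤s (s≤s z≤n)) j = punchIn j zero , punchInᵢ≢i j zero

transpose : BipEdgeSet p q → BipEdgeSet q p
transpose F j i = F i j

+[m+n]-+m≡+n : ∀ m n → + (m + n) - + m ≡ + n
+[m+n]-+m≡+n m n =
  trans ([+m]-[+n]≡m⊖n (m + n) m) (trans (⊖-≥ (m≤m+n m n)) (cong +_ (m+n∸m≡n m n)))

module _ (G : SimpleGraph) where

  private
    V : List (Fin (n G))
    V = allFin (n G)

  isHom-sound : (F : BipEdgeSet p q) {α : Fin p → Fin (n G)} {β : Fin q → Fin (n G)} →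
                isHom F G α β ≡ true → ∀ i j → F i j ≡ true → adj G (α i) (β j) ≡ true
  isHom-sound F {α} {β} hom i j Fij =
    subst (λ b → not b ∨ adj G (α i) (β j) ≡ true) Fij
          (all-allFin⁻ _ (all-allFin⁻ _ hom i) j)

  isHom-complete : (F : BipEdgeSet p q) {α : Fin p → Fin (n G)} {β : Fin q → Fin (n G)} →
                   (∀ i j → F i j ≡ true → adj G (α i) (β j) ≡ true) → isHom F G α β ≡ true
  isHom-complete F edges = all-allFin⁺ _ (λ i → all-allFin⁺ _ (λ j → not-∨-intro (edges i j)))

  isHom-transpose : (F : BipEdgeSet p q) (α : Fin p → Fin (n G)) (β : Fin q → Fin (n G)) →
                    isHom (transpose F) G β α ≡ isHom F G α β
  isHom-transpose F α β = ⇔→≡ {z = true} (mk⇔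
    (λ homᵀ → isHom-complete F (λ i j Fij →
      trans (adj-sym G (α i) (β j)) (isHom-sound (transpose F) homᵀ j i Fij)))
    (λ hom → isHom-complete (transpose F) (λ j i Fij →
      trans (adj-sym G (β j) (α i)) (isHom-sound F hom i j Fij))))

  newHom : BipEdgeSet p q → BipEdgeSet p q → ℕ
  newHom {p} {q} F F' =
    ∑[ α ∈ allFuns p (n G) ] count (λ β → isHom F' G α β ∧ not (isHom F G α β)) (allFuns q (n G))

  hom-split : (F F' : BipEdgeSet p q) → F' ⊆ₑ F → hom F' G ≡ hom F G + newHom F F'
  hom-split {p} {q} F F' F'⊆F = begin
    hom F' G
      ≡⟨ ∑-cong Fα (λ α → ∑-cong Fβ (λ β → bit-split (λ hom → isHom-complete F' (λ i j F'ij →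
           isHom-sound F hom i j (F'⊆F i j F'ij))))) ⟩
    ∑[ α ∈ Fα ] ∑[ β ∈ Fβ ] (bit (isHom F G α β) + bit (isHom F' G α β ∧ not (isHom F G α β)))
      ≡⟨ ∑-cong Fα (λ α → ∑-+ Fβ _ _) ⟩
    ∑[ α ∈ Fα ] (count (isHom F G α) Fβ + count (λ β → isHom F' G α β ∧ not (isHom F G α β)) Fβ)
      ≡⟨ ∑-+ Fα _ _ ⟩
    hom F G + newHom F F' ∎
    where
    open ≡-Reasoning
    Fα = allFuns p (n G)
    Fβ = allFuns q (n G)

  newHom-transpose : (F F' : BipEdgeSet p q) → newHom (transpose F) (transpose F') ≡ newHom F F'
  newHom-transpose {p} {q} F F' =
    trans (∑-cong (allFuns q (n G)) (λ β → ∑-cong (allFuns p (n G)) (λ α →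
            cong₂ (λ h h' → bit (h' ∧ not h)) (isHom-transpose F α β) (isHom-transpose F' α β))))
          (∑-comm (allFuns q (n G)) (allFuns p (n G)) _)

  isDTriple : Fin (n G) → Fin (n G) → Fin (n G) → Bool
  isDTriple u v w = not (adj G u v) ∧ goodW G u v w

  dTriple-parts : ∀ {u v w} → isDTriple u v w ≡ true → adj G u v ≡ false × adj G u w ≡ true
  dTriple-parts {u} {v} {w} D with ∧-true⁻ {not (adj G u v)} D
  ... | u≁v , good = not-injective u≁v , proj₁ (∧-true⁻ {adj G u w} good)

  dTripleSum : ℕ → ℕ
  dTripleSum e = ∑[ u ∈ V ] ∑[ v ∈ V ] ∑[ w ∈ V ] (bit (isDTriple u v w) * commonNbrs G v w ^ e)

  eta≤dTripleSum : ∀ p q → eta G p q ≤ dTripleSum ((p ⊔ q) ∸ 1)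
  eta≤dTripleSum p q = ∑-mono-≤ V (λ u → ∑-mono-≤ V (λ v → guarded (adj G u v)))
    where
    if-≤ : ∀ b x → (if b then x else 0) ≤ x
    if-≤ true  x = ≤-refl
    if-≤ false x = z≤n
    e = (p ⊔ q) ∸ 1
    guarded : ∀ {u v} (a : Bool) {o : Bool} →
              (if not a ∧ o then ∑[ w ∈ V ] (if goodW G u v w then commonNbrs G v w ^ e else 0) else 0)
              ≤ ∑[ w ∈ V ] (bit (not a ∧ goodW G u v w) * commonNbrs G v w ^ e)
    guarded true  = z≤n
    guarded {u} {v} false {o} =
      ≤-trans (if-≤ o _) (≤-reflexive (∑-cong V (λ w → if-then-0 (goodW G u v w))))
      where
      if-then-0 : ∀ b {x} → (if b then x else 0) ≡ bit b * x
      if-then-0 true  {x} = sym (+-identityʳ x)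
      if-then-0 false     = refl

  module _ (F F' : BipEdgeSet p q) (i : Fin p) {j j₀ : Fin q} (j₀≢j : j₀ ≢ j)
           (Fij : F i j ≡ true) (F'ij : F' i j ≡ false) where

    private
      Fα = allFuns p (n G)
      Fβ = allFuns q (n G)

    rowBox : (u v w : Fin (n G)) → Fin p → Fin (n G) → Bool
    rowBox u v w t x = if does (t ≟ i) then does (x ≟ u) else (adj G v x ∧ adj G w x)

    colBox : (v w : Fin (n G)) → Fin q → Fin (n G) → Bool
    colBox v w t y = if does (t ≟ j) then does (y ≟ v) else does (y ≟ w)

    isWitness : (u v w : Fin (n G)) → (Fin p → Fin (n G)) → (Fin q → Fin (n G)) → Bool
    isWitness u v w α β = (isDTriple u v w ∧ inBox (rowBox u v w) α) ∧ inBox (colBox v w) β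

    count-rowBox : ∀ u v w → count (inBox (rowBox u v w)) Fα ≡ commonNbrs G v w ^ (p ∸ 1)
    count-rowBox u v w = trans (count-inBox (rowBox u v w)) (∏-const-except _ i
      (trans (∑-cong V (λ x → cong bit (if-yes (i ≟ i) refl))) (count-≟ u))
      (λ t t≢i → ∑-cong V (λ x → cong bit (if-no (t ≟ i) t≢i))))

    count-colBox : ∀ v w → count (inBox (colBox v w)) Fβ ≡ 1
    count-colBox v w =
      trans (count-inBox (colBox v w)) (trans (∏-const _ (λ t → slice (does (t ≟ j)))) (^-zeroˡ q))
      where
      slice : ∀ b → count (λ y → if b then does (y ≟ v) else does (y ≟ w)) V ≡ 1
      slice true  = count-≟ v
      slice false = count-≟ w

    count-witness : ∀ u v w →
      ∑[ α ∈ Fα ] count (isWitness u v w α) Fβ ≡ bit (isDTriple u v w) * commonNbrs G v w ^ (p ∸ 1)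
    count-witness u v w = begin
      ∑[ α ∈ Fα ] ∑[ β ∈ Fβ ] bit (isWitness u v w α β)
        ≡⟨ ∑-cong Fα (λ α → ∑-cong Fβ (λ β →
             trans (bit-∧ (D ∧ R α) (C β)) (cong (_* bit (C β)) (bit-∧ D (R α))))) ⟩
      ∑[ α ∈ Fα ] ∑[ β ∈ Fβ ] (bit D * bit (R α) * bit (C β))
        ≡⟨ ∑-cong Fα (λ α → ∑-*ˡ Fβ (bit D * bit (R α)) (bit ∘ C)) ⟩
      ∑[ α ∈ Fα ] (bit D * bit (R α) * count C Fβ)
        ≡⟨ ∑-cong Fα (λ α → trans (cong (bit D * bit (R α) *_) (count-colBox v w)) (*-identityʳ _)) ⟩
      ∑[ α ∈ Fα ] (bit D * bit (R α))
        ≡⟨ ∑-*ˡ Fα (bit D) (bit ∘ R) ⟩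
      bit D * count R Fα
        ≡⟨ cong (bit D *_) (count-rowBox u v w) ⟩
      bit D * commonNbrs G v w ^ (p ∸ 1) ∎
      where
      open ≡-Reasoning
      D = isDTriple u v w
      R = inBox (rowBox u v w)
      C = inBox (colBox v w)

    witness-parts : ∀ u v w α β → isWitness u v w α β ≡ true →
      isDTriple u v w ≡ true × inBox (rowBox u v w) α ≡ true × inBox (colBox v w) β ≡ true
    witness-parts u v w α β W with ∧-true⁻ {isDTriple u v w ∧ inBox (rowBox u v w) α} W
    ... | DR , C with ∧-true⁻ {isDTriple u v w} DR
    ...   | D , R = D , R , C

    witness-determined : ∀ u v w α β → isWitness u v w α β ≡ true →
                         u ≡ α i × v ≡ β j × w ≡ β j₀
    witness-determined u v w α β W =
        sym (does-true⇒ (α i ≟ u) (trans (sym (if-yes (i ≟ i) refl)) (inBox-at (rowBox u v w) α row i)))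
      , sym (does-true⇒ (β j ≟ v) (trans (sym (if-yes (j ≟ j) refl)) (inBox-at (colBox v w) β col j)))
      , sym (does-true⇒ (β j₀ ≟ w) (trans (sym (if-no (j₀ ≟ j) j₀≢j)) (inBox-at (colBox v w) β col j₀)))
      where
      row = proj₁ (proj₂ (witness-parts u v w α β W))
      col = proj₂ (proj₂ (witness-parts u v w α β W))

    witness⇒newHom : ∀ α β → isWitness (α i) (β j) (β j₀) α β ≡ true →
                     isHom F' G α β ∧ not (isHom F G α β) ≡ true
    witness⇒newHom α β W = cong₂ _∧_ (isHom-complete F' edges) (cong not (¬-not not-hom))
      where
      parts = witness-parts (α i) (β j) (β j₀) α β W
      a≁b : adj G (α i) (β j) ≡ false
      a≁b = proj₁ (dTriple-parts (proj₁ parts))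
      a∼c : adj G (α i) (β j₀) ≡ true
      a∼c = proj₂ (dTriple-parts (proj₁ parts))
      row : ∀ t → t ≢ i → adj G (β j) (α t) ∧ adj G (β j₀) (α t) ≡ true
      row t t≢i = trans (sym (if-no (t ≟ i) t≢i))
        (inBox-at (rowBox (α i) (β j) (β j₀)) α (proj₁ (proj₂ parts)) t)
      col : ∀ t → t ≢ j → β t ≡ β j₀
      col t t≢j = does-true⇒ (β t ≟ β j₀)
        (trans (sym (if-no (t ≟ j) t≢j)) (inBox-at (colBox (β j) (β j₀)) β (proj₂ (proj₂ parts)) t))
      edges : ∀ i' j' → F' i' j' ≡ true → adj G (α i') (β j') ≡ true
      edges i' j' F'i'j' with i' ≟ i | j' ≟ j
      ... | yes refl | yes refl = contradiction (trans (sym F'i'j') F'ij) λ ()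
      ... | yes refl | no j'≢j  = subst (λ y → adj G (α i) y ≡ true) (sym (col j' j'≢j)) a∼c
      ... | no i'≢i  | yes refl = trans (adj-sym G (α i') (β j)) (proj₁ (∧-true⁻ (row i' i'≢i)))
      ... | no i'≢i  | no j'≢j  = subst (λ y → adj G (α i') y ≡ true) (sym (col j' j'≢j))
                                    (trans (adj-sym G (α i') (β j₀)) (proj₂ (∧-true⁻ (row i' i'≢i))))
      not-hom : isHom F G α β ≢ true
      not-hom hom = contradiction (trans (sym (isHom-sound F hom i j Fij)) a≁b) λ ()

    ∑-witness-single : ∀ α β →
      ∑[ u ∈ V ] ∑[ v ∈ V ] ∑[ w ∈ V ] bit (isWitness u v w α β)
      ≡ bit (isWitness (α i) (β j) (β j₀) α β)
    ∑-witness-single α β =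
      trans (∑-allFin-single _ (α i) (λ u u≢ → ∑-zero V (λ v → ∑-zero V (λ w → off (u≢ ∘ proj₁)))))
     (trans (∑-allFin-single _ (β j) (λ v v≢ → ∑-zero V (λ w → off (v≢ ∘ proj₁ ∘ proj₂))))
            (∑-allFin-single _ (β j₀) (λ w w≢ → off (w≢ ∘ proj₂ ∘ proj₂))))
      where
      off : ∀ {u v w} → ¬ (u ≡ α i × v ≡ β j × w ≡ β j₀) → bit (isWitness u v w α β) ≡ 0
      off {u} {v} {w} elsewhere = cong bit (¬-not (elsewhere ∘ witness-determined u v w α β))

    dTripleSum≤newHom : dTripleSum (p ∸ 1) ≤ newHom F F'
    dTripleSum≤newHom = begin
      dTripleSum (p ∸ 1)
        ≡⟨ ∑-cong V (λ u → ∑-cong V (λ v → ∑-cong V (λ w → sym (count-witness u v w)))) ⟩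
      ∑[ u ∈ V ] ∑[ v ∈ V ] ∑[ w ∈ V ] ∑[ α ∈ Fα ] ∑[ β ∈ Fβ ] W u v w α β
        ≡⟨ ∑-cong V (λ u → ∑-cong V (λ v → ∑-comm² V Fα Fβ (λ w → W u v w))) ⟩
      ∑[ u ∈ V ] ∑[ v ∈ V ] ∑[ α ∈ Fα ] ∑[ β ∈ Fβ ] ∑[ w ∈ V ] W u v w α β
        ≡⟨ ∑-cong V (λ u → ∑-comm² V Fα Fβ (λ v α β → ∑[ w ∈ V ] W u v w α β)) ⟩
      ∑[ u ∈ V ] ∑[ α ∈ Fα ] ∑[ β ∈ Fβ ] ∑[ v ∈ V ] ∑[ w ∈ V ] W u v w α β
        ≡⟨ ∑-comm² V Fα Fβ (λ u α β → ∑[ v ∈ V ] ∑[ w ∈ V ] W u v w α β) ⟩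
      ∑[ α ∈ Fα ] ∑[ β ∈ Fβ ] ∑[ u ∈ V ] ∑[ v ∈ V ] ∑[ w ∈ V ] W u v w α β
        ≡⟨ ∑-cong Fα (λ α → ∑-cong Fβ (∑-witness-single α)) ⟩
      ∑[ α ∈ Fα ] ∑[ β ∈ Fβ ] W (α i) (β j) (β j₀) α β
        ≤⟨ ∑-mono-≤ Fα (λ α → ∑-mono-≤ Fβ (λ β → bit-mono (witness⇒newHom α β))) ⟩
      newHom F F' ∎
      where
      open ≤-Reasoning
      W : (u v w : Fin (n G)) → (Fin p → Fin (n G)) → (Fin q → Fin (n G)) → ℕ
      W u v w α β = bit (isWitness u v w α β)

  eta≤newHom : 2 ≤ p → 2 ≤ q → (F F' : BipEdgeSet p q) (i : Fin p) (j : Fin q) →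
               F i j ≡ true → F' i j ≡ false → eta G p q ≤ newHom F F'
  eta≤newHom {p} {q} 2≤p 2≤q F F' i j Fij F'ij with ≤-total q p
  ... | inj₁ q≤p = begin
    eta G p q                  ≤⟨ eta≤dTripleSum p q ⟩
    dTripleSum ((p ⊔ q) ∸ 1)   ≡⟨ cong (λ e → dTripleSum (e ∸ 1)) (m≥n⇒m⊔n≡m q≤p) ⟩
    dTripleSum (p ∸ 1)         ≤⟨ dTripleSum≤newHom F F' i (proj₂ (other-index 2≤q j)) Fij F'ij ⟩
    newHom F F'                ∎
    where open ≤-Reasoning
  ... | inj₂ p≤q = begin
    eta G p q                                  ≤⟨ eta≤dTripleSum p q ⟩
    dTripleSum ((p ⊔ q) ∸ 1)                   ≡⟨ cong (λ e → dTripleSum (e ∸ 1)) (m≤n⇒m⊔n≡n p≤q) ⟩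
    dTripleSum (q ∸ 1)                         ≤⟨ dTripleSum≤newHom (transpose F) (transpose F') j
                                                    (proj₂ (other-index 2≤p i)) Fij F'ij ⟩
    newHom (transpose F) (transpose F')        ≡⟨ newHom-transpose F F' ⟩
    newHom F F'                                ∎
    where open ≤-Reasoning

eta≤removal-gain : (G : SimpleGraph) → 2 ≤ p → 2 ≤ q → (F F' : BipEdgeSet p q) →
                   RemoveOneEdge F F' → + eta G p q ≤ℤ (+ hom F' G - + hom F G)
eta≤removal-gain {p} {q} G 2≤p 2≤q F F' removal@(i , j , Fij , F'ij , _) =
  subst (+ eta G p q ≤ℤ_) (sym gain) (+≤+ (eta≤newHom G 2≤p 2≤q F F' i j Fij F'ij))
  where
  gain : + hom F' G - + hom F G ≡ + newHom G F F'
  gain = trans (cong (λ h → + h - + hom F G) (hom-split G F F' (RemoveOneEdge⇒⊆ₑ F F' removal)))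
               (+[m+n]-+m≡+n (hom F G) (newHom G F F'))

lemma4 : (p q : ℕ) → 2 ≤ p → 2 ≤ q →
         (F : BipEdgeSet p q) →
         (G : SimpleGraph) → IsBipartite G →
         (ℓ : ℕ) → ℓ ≡ p * q ∸ edgeCount F →
         (Fs : ℕ → BipEdgeSet p q) →
         (∀ i j → Fs 0 i j ≡ complete i j) →
         (∀ i j → Fs ℓ i j ≡ F i j) →
         (∀ k → 1 ≤ k → k ≤ ℓ → RemoveOneEdge (Fs (k ∸ 1)) (Fs k)) →
         ∀ k → 1 ≤ k → k ≤ ℓ →
         + eta G p q ≤ℤ (+ hom (Fs k) G - + hom (Fs (k ∸ 1)) G)
lemma4 p q 2≤p 2≤q F G _ ℓ _ Fs _ _ step k 1≤k k≤ℓ =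
  eta≤removal-gain G 2≤p 2≤q (Fs (k ∸ 1)) (Fs k) (step k 1≤k k≤ℓ)
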